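{- Define $\alpha_k=\frac{1}{2^{k+2}-2}$ for $k\ge0$, and sequences $\gamma_k,\nu_k$ by $\gamma_0=0$, $\nu_0=1$ and, for $k\ge1$, \[ \gamma_k=\frac{1+\gamma_{k-1}+\alpha_{k-1}\nu_{k-1}}{2(1+\alpha_{k-1})},\qquad \nu_k=\frac{1+\nu_{k-1}}{2}+\frac{(1+\gamma_{k-1}-\nu_{k-1})\alpha_{k-1}}{2(1+\alpha_{k-1})}. \] Then there exists a real constant $c$ such that for all $k\ge 0$, \[ \left|\nu_k-\gamma_k-\frac{k+1+c}{2^{k+1}}\right|\le\frac{k+7}{4^k}. \] -}

module Defs where

open import Data.Nat as ℕ using (ℕ; zero; suc; _^_; _∸_)
open import Data.Nat.Properties as ℕP using (m^n≢0)
open import Data.Integer using (+_)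
open import Data.Rational using (ℚ; _/_; _+_; _-_; _*_; _÷_; _≤_; ∣_∣; 1ℚ; 0ℚ; Positive; NonZero)
open import Data.Rational.Properties using (normalize-pos; pos+pos⇒pos; pos*pos⇒pos; pos⇒nonZero)
open import Data.Product using (_×_; _,_; proj₁; proj₂)

2ℚ : ℚ
2ℚ = + 2 / 1

-- α_k = 1 / (2^{k+2} - 2).  Since 2^{k+2} ≥ 4, the natural number
-- 2^{k+2} - 2 equals suc (2^{k+2} ∸ 3); writing it this way makes
-- the denominator manifestly nonzero.
α : ℕ → ℚ
α k = + 1 / suc (2 ^ (k ℕ.+ 2) ∸ 3)

α-pos : ∀ k → Positive (α k)
α-pos k = normalize-pos 1 (suc (2 ^ (k ℕ.+ 2) ∸ 3))

den-nonZero : ∀ k → NonZero (2ℚ * (1ℚ + α k))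
den-nonZero k = pos⇒nonZero (2ℚ * (1ℚ + α k))
  {{pos*pos⇒pos 2ℚ {{_}} (1ℚ + α k) {{pos+pos⇒pos 1ℚ {{_}} (α k) {{α-pos k}}}}}}

γν : ℕ → ℚ × ℚ
γν zero = 0ℚ , 1ℚ
γν (suc k) with γν k
... | g , v =
  ((1ℚ + g + α k * v) ÷ (2ℚ * (1ℚ + α k))) {{den-nonZero k}}
  , ((1ℚ + v) ÷ 2ℚ + ((1ℚ + g - v) * α k ÷ (2ℚ * (1ℚ + α k))) {{den-nonZero k}})

γ : ℕ → ℚ
γ k = proj₁ (γν k)

ν : ℕ → ℚ
ν k = proj₂ (γν k)

-- Real numbers, constructively (Bishop): a real number is given by a
-- regular sequence of rationals  c_0, c_1, …  with
--   |c_m - c_n| ≤ 1/(m+1) + 1/(n+1),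
-- so that |c_n - c| ≤ 1/(n+1) for the real c it represents.
record ℝ : Set where
  field
    seq : ℕ → ℚ
    reg : ∀ m n → ∣ seq m - seq n ∣ ≤ (+ 1 / suc m) + (+ 1 / suc n)

open ℝ public

-- (k + 1 + c_n) / 2^{k+1}: the n-th approximant of the real number
-- (k + 1 + c) / 2^{k+1}  (its approximants are again within 1/(n+1)).
approx : ℕ → ℝ → ℕ → ℚ
approx k c n = (+ suc k / 1 + seq c n) * (+ 1 / (2 ^ suc k)) {{m^n≢0 2 (suc k)}}

-- |q - y| ≤ b for rationals q, b and a real y whose n-th approximant
-- y_n satisfies |y_n - y| ≤ 1/(n+1):  ∀ n, |q - y_n| ≤ b + 1/(n+1).
DistLe : ℚ → (ℕ → ℚ) → ℚ → Set
DistLe q y b = ∀ n → ∣ q - y n ∣ ≤ b + (+ 1 / suc n)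

bound : ℕ → ℚ
bound k = (+ (k ℕ.+ 7) / (4 ^ k)) {{m^n≢0 4 k}}

-- Scale the gap: e_k = 2^{k+1} (ν_k - γ_k).  Since α_k (2^{k+2} - 2) = 1 the recurrence becomes
--   e_{k+1} (1 + α_k) = 1 + 2 α_k + (1 - α_k) e_k,
-- so e_k ≥ 1, and f_k = e_k - (k + 1) has decrements (f_k - f_{k+1}) (1 + α_k) = α_k (2 e_k - 1) ≥ 0.
-- Hence f_k ≤ f_0 = 1, i.e. e_k ≤ k + 2, and with α_k 2^{k+1} ≤ 1 + α_k this gives
--   0 ≤ f_k - f_{k+1} ≤ (2k + 3) / 2^{k+1} = T_k - T_{k+1},   where T_k = (4k + 10) / 2^{k+1}.
-- So f converges to some c with |f_k - c| ≤ T_k (constructively, c has approximants f_{2n+8},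
-- as T_{2n+8} ≤ 1/(n+1)), and ν_k - γ_k - (k + 1 + c) / 2^{k+1} = (f_k - c) / 2^{k+1} is at most
-- (4k + 10) / 4^{k+1} ≤ (k + 7) / 4^k in absolute value.

module Submission where

open import Defs
open import Data.Nat as ℕ using (ℕ; zero; suc; _^_; _∸_; _≤′_; ≤′-refl; ≤′-step)
open import Data.Nat.Literals using () renaming (number to ℕ-number)
import Data.Nat.Properties as ℕₚ
import Data.Nat.Tactic.RingSolver as ℕ
open import Data.Integer as ℤ using (+_)
import Data.Integer.Properties as ℤₚ
import Data.Integer.Tactic.RingSolver as ℤ
open import Data.Integer.GCD using (gcd)
open import Data.Rational
open import Data.Rational.Literals using (fromℤ) renaming (number to ℚ-number)
open import Data.Rational.Properties
import Data.Rational.Unnormalised as ℚᵘ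
import Data.Rational.Unnormalised.Properties as ℚᵘ
open import Data.Product using (∃; _,_)
open import Data.Sum using (inj₁; inj₂)
open import Data.Unit using (tt)
open import Agda.Builtin.FromNat using (Number; fromNat)
open import Level using (0ℓ)
open import Relation.Binary.PropositionalEquality
open import Relation.Nullary.Decidable using (dec⇒maybe)
open import Tactic.RingSolver using (solve-∀)
open import Tactic.RingSolver.Core.AlmostCommutativeRing using (AlmostCommutativeRing; fromCommutativeRing)

instance
  ℕ-literals : Number ℕ
  ℕ-literals = ℕ-number

  ℚ-literals : Number ℚ
  ℚ-literals = ℚ-number

-- The zero test lets the normaliser drop cancelled monomials.
ring : AlmostCommutativeRing 0ℓ 0ℓ
ring = fromCommutativeRing +-*-commutativeRing (λ p → dec⇒maybe (0ℚ ≟ p))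

-- Natural numbers as rationals

fromℕ : ℕ → ℚ
fromℕ n = fromℤ (+ n)

fromℕ-homo-+ : ∀ m n → fromℕ (m ℕ.+ n) ≡ fromℕ m + fromℕ n
fromℕ-homo-+ m n = toℚᵘ-injective (ℚᵘ.≃-sym
  (ℚᵘ.≃-trans (toℚᵘ-homo-+ (fromℕ m) (fromℕ n)) (ℚᵘ.*≡* (regroup (+ m) (+ n)))))
  where
  regroup : ∀ a b → (a ℤ.* + 1 ℤ.+ b ℤ.* + 1) ℤ.* + 1 ≡ (a ℤ.+ b) ℤ.* (+ 1 ℤ.* + 1)
  regroup = ℤ.solve-∀

fromℕ-homo-* : ∀ m n → fromℕ (m ℕ.* n) ≡ fromℕ m * fromℕ n
fromℕ-homo-* m n = toℚᵘ-injective (ℚᵘ.≃-sym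
  (ℚᵘ.≃-trans (toℚᵘ-homo-* (fromℕ m) (fromℕ n)) (ℚᵘ.*≡* (cong (ℤ._* + 1) (sym (ℤₚ.pos-* m n))))))

fromℕ-mono-≤ : ∀ {m n} → m ℕ.≤ n → fromℕ m ≤ fromℕ n
fromℕ-mono-≤ {m} {n} m≤n =
  *≤* (subst₂ ℤ._≤_ (sym (ℤₚ.*-identityʳ (+ m))) (sym (ℤₚ.*-identityʳ (+ n))) (ℤ.+≤+ m≤n))

0≤fromℕ : ∀ n → 0ℚ ≤ fromℕ n
0≤fromℕ n = fromℕ-mono-≤ ℕ.z≤n

↥[i/n]*n≡i*↧[i/n] : ∀ i n .{{_ : ℕ.NonZero n}} → ↥ (i / n) ℤ.* + n ≡ i ℤ.* ↧ (i / n)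
↥[i/n]*n≡i*↧[i/n] i n = begin
  ↥ (i / n) ℤ.* + n                ≡⟨ cong (↥ (i / n) ℤ.*_) (↧-/ i n) ⟨
  ↥ (i / n) ℤ.* (↧ (i / n) ℤ.* g)  ≡⟨ regroup (↥ (i / n)) (↧ (i / n)) g ⟩
  ↧ (i / n) ℤ.* (↥ (i / n) ℤ.* g)  ≡⟨ cong (↧ (i / n) ℤ.*_) (↥-/ i n) ⟩
  ↧ (i / n) ℤ.* i                  ≡⟨ ℤₚ.*-comm (↧ (i / n)) i ⟩
  i ℤ.* ↧ (i / n)                  ∎
  where
  open ≡-Reasoning
  g = gcd i (+ n)
  regroup : ∀ a b c → a ℤ.* (b ℤ.* c) ≡ b ℤ.* (a ℤ.* c)
  regroup = ℤ.solve-∀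

n/1≡fromℕ : ∀ n → + n / 1 ≡ fromℕ n
n/1≡fromℕ n = ≃⇒≡ (*≡* (↥[i/n]*n≡i*↧[i/n] (+ n) 1))

m/n*n≡m : ∀ m n .{{_ : ℕ.NonZero n}} → (+ m / n) * fromℕ n ≡ fromℕ m
m/n*n≡m m n = cross⇒*n≡m (+ m / n) (↥[i/n]*n≡i*↧[i/n] (+ m) n)
  where
  cross⇒*n≡m : ∀ p → ↥ p ℤ.* + n ≡ + m ℤ.* ↧ p → p * fromℕ n ≡ fromℕ m
  cross⇒*n≡m p@record{} eq = toℚᵘ-injective (ℚᵘ.≃-trans (toℚᵘ-homo-* p (fromℕ n))
    (ℚᵘ.*≡* (trans (ℤₚ.*-identityʳ _) (trans eq (cong (+ m ℤ.*_) (sym (ℤₚ.*-identityʳ _)))))))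

0≤m/n : ∀ m n .{{_ : ℕ.NonZero n}} → 0ℚ ≤ + m / n
0≤m/n m n = nonNegative⁻¹ (+ m / n) {{normalize-nonNeg m n}}

p≤p+q : ∀ {p q} → 0ℚ ≤ q → p ≤ p + q
p≤p+q {p} 0≤q = subst (_≤ p + _) (+-identityʳ p) (+-monoʳ-≤ p 0≤q)

p≤q+p : ∀ {p q} → 0ℚ ≤ q → p ≤ q + p
p≤q+p {p} {q} 0≤q = subst (p ≤_) (+-comm p q) (p≤p+q 0≤q)

∣p-q∣≡∣q-p∣ : ∀ p q → ∣ p - q ∣ ≡ ∣ q - p ∣
∣p-q∣≡∣q-p∣ p q = trans (sym (∣-p∣≡∣p∣ (p - q))) (cong ∣_∣ (-[p-q]≡q-p p q))
  where
  -[p-q]≡q-p : ∀ p q → - (p - q) ≡ q - p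
  -[p-q]≡q-p = solve-∀ ring

p≤q⇒0≤q-p : ∀ {p q} → p ≤ q → 0ℚ ≤ q - p
p≤q⇒0≤q-p {p} {q} p≤q = subst (_≤ q - p) (+-inverseʳ p) (+-monoˡ-≤ (- p) p≤q)

p-q≤p : ∀ {p q} → 0ℚ ≤ q → p - q ≤ p
p-q≤p {p} 0≤q = subst (p - _ ≤_) (+-identityʳ p) (+-monoʳ-≤ p (neg-antimono-≤ 0≤q))

0≤* : ∀ {p q} → 0ℚ ≤ p → 0ℚ ≤ q → 0ℚ ≤ p * q
0≤* {p} {q} 0≤p 0≤q = subst (_≤ p * q) (*-zeroˡ q) (*-monoʳ-≤-nonNeg q {{nonNegative 0≤q}} 0≤p)

*-monoˡ-≤-0≤ : ∀ {p q r} → 0ℚ ≤ r → p ≤ q → r * p ≤ r * q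
*-monoˡ-≤-0≤ {r = r} 0≤r = *-monoˡ-≤-nonNeg r {{nonNegative 0≤r}}

*-monoʳ-≤-0≤ : ∀ {p q r} → 0ℚ ≤ r → p ≤ q → p * r ≤ q * r
*-monoʳ-≤-0≤ {r = r} 0≤r = *-monoʳ-≤-nonNeg r {{nonNegative 0≤r}}

1/n*m≤1 : ∀ {m n} .{{_ : ℕ.NonZero n}} → m ℕ.≤ n → + 1 / n * fromℕ m ≤ 1ℚ
1/n*m≤1 {m} {n} m≤n = begin
  + 1 / n * fromℕ m  ≤⟨ *-monoˡ-≤-0≤ (0≤m/n 1 n) (fromℕ-mono-≤ m≤n) ⟩
  + 1 / n * fromℕ n  ≡⟨ m/n*n≡m 1 n ⟩
  1ℚ                 ∎
  where open ≤-Reasoning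

1/n≤1 : ∀ n .{{_ : ℕ.NonZero n}} → + 1 / n ≤ 1ℚ
1/n≤1 n = subst (_≤ 1ℚ) (*-identityʳ (+ 1 / n)) (1/n*m≤1 (ℕ.>-nonZero⁻¹ n))

-- Sequences whose decrements are dominated by those of a nonnegative sequence

telescope : ∀ (a b : ℕ → ℚ) → (∀ j → a j - a (suc j) ≤ b j - b (suc j)) →
            ∀ {i j} → i ℕ.≤ j → a i - a j ≤ b i - b j
telescope a b step i≤j = go (ℕₚ.≤⇒≤′ i≤j)
  where
  split : ∀ x y z → x - z ≡ (x - y) + (y - z)
  split = solve-∀ ring

  go : ∀ {i j} → i ≤′ j → a i - a j ≤ b i - b j
  go {i} ≤′-refl = ≤-reflexive (trans (+-inverseʳ (a i)) (sym (+-inverseʳ (b i))))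
  go {i} (≤′-step {n = j} i≤j) = begin
    a i - a (suc j)                        ≡⟨ split (a i) (a j) (a (suc j)) ⟩
    (a i - a j) + (a j - a (suc j))        ≤⟨ +-mono-≤ (go i≤j) (step j) ⟩
    (b i - b j) + (b j - b (suc j))        ≡⟨ split (b i) (b j) (b (suc j)) ⟨
    b i - b (suc j)                        ∎
    where open ≤-Reasoning

module Limit (f T : ℕ → ℚ) (N : ℕ → ℕ)
  (0≤Δf : ∀ j → 0ℚ ≤ f j - f (suc j))
  (Δf≤ΔT : ∀ j → f j - f (suc j) ≤ T j - T (suc j))
  (0≤T : ∀ j → 0ℚ ≤ T j)
  (T∘N≤1/suc : ∀ n → T (N n) ≤ + 1 / suc n)
  where

  ∣f-f∣≤T : ∀ {i j} → i ℕ.≤ j → ∣ f i - f j ∣ ≤ T i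
  ∣f-f∣≤T {i} {j} i≤j = begin
    ∣ f i - f j ∣  ≡⟨ 0≤p⇒∣p∣≡p (telescope (λ _ → 0ℚ) f 0≤Δf i≤j) ⟩
    f i - f j      ≤⟨ telescope f T Δf≤ΔT i≤j ⟩
    T i - T j      ≤⟨ p-q≤p (0≤T j) ⟩
    T i            ∎
    where open ≤-Reasoning

  ∣f-f∣≤T+T : ∀ i j → ∣ f i - f j ∣ ≤ T i + T j
  ∣f-f∣≤T+T i j with ℕₚ.≤-total i j
  ... | inj₁ i≤j = ≤-trans (∣f-f∣≤T i≤j) (p≤p+q (0≤T j))
  ... | inj₂ j≤i = begin
    ∣ f i - f j ∣  ≡⟨ ∣p-q∣≡∣q-p∣ (f i) (f j) ⟩
    ∣ f j - f i ∣  ≤⟨ ∣f-f∣≤T j≤i ⟩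
    T j            ≤⟨ p≤q+p (0≤T i) ⟩
    T i + T j      ∎
    where open ≤-Reasoning

  limit : ℝ
  limit .seq n   = f (N n)
  limit .reg m n = ≤-trans (∣f-f∣≤T+T (N m) (N n)) (+-mono-≤ (T∘N≤1/suc m) (T∘N≤1/suc n))

  ∣f-limit∣≤T+1/suc : ∀ k n → ∣ f k - seq limit n ∣ ≤ T k + + 1 / suc n
  ∣f-limit∣≤T+1/suc k n = ≤-trans (∣f-f∣≤T+T k (N n)) (+-monoʳ-≤ (T k) (T∘N≤1/suc n))

-- The scaled gap e_k = 2^{k+1} (ν_k - γ_k)

δ : ℕ → ℚ
δ k = ν k - γ k

δ-rec : ∀ k → δ (suc k) * (2ℚ * (1ℚ + α k)) ≡ 2ℚ * α k + (1ℚ - α k) * δ k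
δ-rec k = cleared (γ k) (ν k) (α k) (*-inverseˡ 2ℚ) (*-inverseˡ (2ℚ * (1ℚ + α k)) {{den-nonZero k}})
  where
  -- h and u stand for the inverses 1/2 and 1/(2 (1 + a)) introduced by _÷_.
  cleared : ∀ g v a {h u} → h * 2ℚ ≡ 1ℚ → u * (2ℚ * (1ℚ + a)) ≡ 1ℚ →
            ((1ℚ + v) * h + (1ℚ + g - v) * a * u - (1ℚ + g + a * v) * u) * (2ℚ * (1ℚ + a))
              ≡ 2ℚ * a + (1ℚ - a) * (v - g)
  cleared g v a {h} {u} h*2≡1 u*D≡1 = begin
    ((1ℚ + v) * h + (1ℚ + g - v) * a * u - (1ℚ + g + a * v) * u) * (2ℚ * (1ℚ + a))
      ≡⟨ expand g v a h u ⟩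
    (1ℚ + v) * (1ℚ + a) * (h * 2ℚ) + ((1ℚ + g - v) * a - (1ℚ + g + a * v)) * (u * (2ℚ * (1ℚ + a)))
      ≡⟨ cong₂ (λ x y → (1ℚ + v) * (1ℚ + a) * x + ((1ℚ + g - v) * a - (1ℚ + g + a * v)) * y) h*2≡1 u*D≡1 ⟩
    (1ℚ + v) * (1ℚ + a) * 1ℚ + ((1ℚ + g - v) * a - (1ℚ + g + a * v)) * 1ℚ
      ≡⟨ collect g v a ⟩
    2ℚ * a + (1ℚ - a) * (v - g)
      ∎
    where
    open ≡-Reasoning
    expand : ∀ g v a h u →
             ((1ℚ + v) * h + (1ℚ + g - v) * a * u - (1ℚ + g + a * v) * u) * (2ℚ * (1ℚ + a))
               ≡ (1ℚ + v) * (1ℚ + a) * (h * 2ℚ) + ((1ℚ + g - v) * a - (1ℚ + g + a * v)) * (u * (2ℚ * (1ℚ + a)))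
    expand = solve-∀ ring
    collect : ∀ g v a → (1ℚ + v) * (1ℚ + a) * 1ℚ + ((1ℚ + g - v) * a - (1ℚ + g + a * v)) * 1ℚ
                        ≡ 2ℚ * a + (1ℚ - a) * (v - g)
    collect = solve-∀ ring

Q : ℕ → ℚ
Q k = fromℕ (2 ^ suc k)

t : ℕ → ℚ
t k = (+ 1 / 2 ^ suc k) {{ℕₚ.m^n≢0 2 (suc k)}}

t*Q≡1 : ∀ k → t k * Q k ≡ 1ℚ
t*Q≡1 k = m/n*n≡m 1 (2 ^ suc k) {{ℕₚ.m^n≢0 2 (suc k)}}

p*Q*t≡p : ∀ k p → p * Q k * t k ≡ p
p*Q*t≡p k p = begin
  p * Q k * t k    ≡⟨ *-assoc p (Q k) (t k) ⟩
  p * (Q k * t k)  ≡⟨ cong (p *_) (trans (*-comm (Q k) (t k)) (t*Q≡1 k)) ⟩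
  p * 1ℚ           ≡⟨ *-identityʳ p ⟩
  p                ∎
  where open ≡-Reasoning

0≤t : ∀ k → 0ℚ ≤ t k
0≤t k = 0≤m/n 1 (2 ^ suc k) {{ℕₚ.m^n≢0 2 (suc k)}}

t≤1 : ∀ k → t k ≤ 1ℚ
t≤1 k = 1/n≤1 (2 ^ suc k) {{ℕₚ.m^n≢0 2 (suc k)}}

p*t≤p : ∀ k {p} → 0ℚ ≤ p → p * t k ≤ p
p*t≤p k {p} 0≤p = subst (p * t k ≤_) (*-identityʳ p) (*-monoˡ-≤-0≤ 0≤p (t≤1 k))

Q-suc : ∀ k → Q (suc k) ≡ 2ℚ * Q k
Q-suc k = fromℕ-homo-* 2 (2 ^ suc k)

2*t-suc≡t : ∀ k → 2ℚ * t (suc k) ≡ t k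
2*t-suc≡t k = begin
  2ℚ * t (suc k)                   ≡⟨ *-identityʳ _ ⟨
  2ℚ * t (suc k) * 1ℚ              ≡⟨ cong (2ℚ * t (suc k) *_) (t*Q≡1 k) ⟨
  2ℚ * t (suc k) * (t k * Q k)     ≡⟨ regroup (t (suc k)) (t k) (Q k) ⟩
  t (suc k) * (2ℚ * Q k) * t k     ≡⟨ cong (λ q → t (suc k) * q * t k) (Q-suc k) ⟨
  t (suc k) * Q (suc k) * t k      ≡⟨ cong (_* t k) (t*Q≡1 (suc k)) ⟩
  1ℚ * t k                         ≡⟨ *-identityˡ (t k) ⟩
  t k                              ∎
  where
  open ≡-Reasoning
  regroup : ∀ s u q → 2ℚ * s * (u * q) ≡ s * (2ℚ * q) * u
  regroup = solve-∀ ring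

α-denominator+2≡2^[k+2] : ∀ k → 2 ℕ.+ suc (2 ^ (k ℕ.+ 2) ∸ 3) ≡ 2 ^ suc (suc k)
α-denominator+2≡2^[k+2] k = begin
  3 ℕ.+ (2 ^ (k ℕ.+ 2) ∸ 3)  ≡⟨ ℕₚ.+-comm 3 _ ⟩
  (2 ^ (k ℕ.+ 2) ∸ 3) ℕ.+ 3  ≡⟨ ℕₚ.m∸n+n≡m 3≤2^[k+2] ⟩
  2 ^ (k ℕ.+ 2)              ≡⟨ cong (2 ^_) (ℕₚ.+-comm k 2) ⟩
  2 ^ suc (suc k)            ∎
  where
  open ≡-Reasoning
  3≤2^[k+2] : 3 ℕ.≤ 2 ^ (k ℕ.+ 2)
  3≤2^[k+2] = ℕₚ.≤-trans (ℕₚ.n≤1+n 3) (ℕₚ.^-monoʳ-≤ 2 (ℕₚ.m≤n+m 2 k))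

α*Q-suc≡1+2α : ∀ k → α k * Q (suc k) ≡ 1ℚ + 2ℚ * α k
α*Q-suc≡1+2α k = begin
  α k * Q (suc k)           ≡⟨ cong (λ n → α k * fromℕ n) (α-denominator+2≡2^[k+2] k) ⟨
  α k * fromℕ (2 ℕ.+ D)     ≡⟨ cong (α k *_) (fromℕ-homo-+ 2 D) ⟩
  α k * (2ℚ + fromℕ D)      ≡⟨ *-distribˡ-+ (α k) 2ℚ (fromℕ D) ⟩
  α k * 2ℚ + α k * fromℕ D  ≡⟨ cong₂ _+_ (*-comm (α k) 2ℚ) (m/n*n≡m 1 D) ⟩
  2ℚ * α k + 1ℚ             ≡⟨ +-comm (2ℚ * α k) 1ℚ ⟩
  1ℚ + 2ℚ * α k             ∎
  where
  open ≡-Reasoning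
  D = suc (2 ^ (k ℕ.+ 2) ∸ 3)

0≤α : ∀ k → 0ℚ ≤ α k
0≤α k = 0≤m/n 1 (suc (2 ^ (k ℕ.+ 2) ∸ 3))

α≤1 : ∀ k → α k ≤ 1ℚ
α≤1 k = 1/n≤1 (suc (2 ^ (k ℕ.+ 2) ∸ 3))

1+α-pos : ∀ k → Positive (1ℚ + α k)
1+α-pos k = pos+pos⇒pos 1ℚ (α k) {{α-pos k}}

α*Q≤1+α : ∀ k → α k * Q k ≤ 1ℚ + α k
α*Q≤1+α k = *-cancelˡ-≤-pos 2ℚ (begin
  2ℚ * (α k * Q k)    ≡⟨ regroup₁ (α k) (Q k) ⟩
  α k * (2ℚ * Q k)    ≡⟨ cong (α k *_) (Q-suc k) ⟨
  α k * Q (suc k)     ≡⟨ α*Q-suc≡1+2α k ⟩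
  1ℚ + 2ℚ * α k       ≤⟨ p≤p+q (0≤fromℕ 1) ⟩
  1ℚ + 2ℚ * α k + 1ℚ  ≡⟨ regroup₂ (α k) ⟩
  2ℚ * (1ℚ + α k)     ∎)
  where
  open ≤-Reasoning
  regroup₁ : ∀ a q → 2ℚ * (a * q) ≡ a * (2ℚ * q)
  regroup₁ = solve-∀ ring
  regroup₂ : ∀ a → 1ℚ + 2ℚ * a + 1ℚ ≡ 2ℚ * (1ℚ + a)
  regroup₂ = solve-∀ ring

e : ℕ → ℚ
e k = δ k * Q k

e-rec : ∀ k → e (suc k) * (1ℚ + α k) ≡ 1ℚ + 2ℚ * α k + (1ℚ - α k) * e k
e-rec k = begin
  δ (suc k) * Q (suc k) * (1ℚ + a)      ≡⟨ cong (λ q → δ (suc k) * q * (1ℚ + a)) (Q-suc k) ⟩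
  δ (suc k) * (2ℚ * Q k) * (1ℚ + a)     ≡⟨ regroup₁ (δ (suc k)) (Q k) a ⟩
  δ (suc k) * (2ℚ * (1ℚ + a)) * Q k     ≡⟨ cong (_* Q k) (δ-rec k) ⟩
  (2ℚ * a + (1ℚ - a) * δ k) * Q k       ≡⟨ regroup₂ (δ k) (Q k) a ⟩
  a * (2ℚ * Q k) + (1ℚ - a) * e k       ≡⟨ cong (λ q → a * q + (1ℚ - a) * e k) (Q-suc k) ⟨
  a * Q (suc k) + (1ℚ - a) * e k        ≡⟨ cong (_+ (1ℚ - a) * e k) (α*Q-suc≡1+2α k) ⟩
  1ℚ + 2ℚ * a + (1ℚ - a) * e k          ∎
  where
  open ≡-Reasoning
  a = α k
  regroup₁ : ∀ x q a → x * (2ℚ * q) * (1ℚ + a) ≡ x * (2ℚ * (1ℚ + a)) * q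
  regroup₁ = solve-∀ ring
  regroup₂ : ∀ x q a → (2ℚ * a + (1ℚ - a) * x) * q ≡ a * (2ℚ * q) + (1ℚ - a) * (x * q)
  regroup₂ = solve-∀ ring

1≤e : ∀ k → 1ℚ ≤ e k
1≤e zero    = ≤ᵇ⇒≤ _
1≤e (suc k) = *-cancelʳ-≤-pos (1ℚ + α k) {{1+α-pos k}} (begin
  1ℚ * (1ℚ + a)                          ≡⟨ *-identityˡ (1ℚ + a) ⟩
  1ℚ + a                                 ≤⟨ p≤p+q (+-mono-≤ (0≤α k) (0≤* (p≤q⇒0≤q-p (α≤1 k)) 0≤e)) ⟩
  1ℚ + a + (a + (1ℚ - a) * e k)          ≡⟨ regroup a (e k) ⟩
  1ℚ + 2ℚ * a + (1ℚ - a) * e k           ≡⟨ e-rec k ⟨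
  e (suc k) * (1ℚ + a)                   ∎)
  where
  open ≤-Reasoning
  a = α k
  0≤e : 0ℚ ≤ e k
  0≤e = ≤-trans (0≤fromℕ 1) (1≤e k)
  regroup : ∀ a x → 1ℚ + a + (a + (1ℚ - a) * x) ≡ 1ℚ + 2ℚ * a + (1ℚ - a) * x
  regroup = solve-∀ ring

f : ℕ → ℚ
f k = e k - fromℕ (suc k)

Δf-rec : ∀ k → (f k - f (suc k)) * (1ℚ + α k) ≡ α k * (2ℚ * e k - 1ℚ)
Δf-rec k = begin
  (e k - K₁ - (e (suc k) - fromℕ (suc (suc k)))) * (1ℚ + a)
    ≡⟨ cong (λ m → (e k - K₁ - (e (suc k) - m)) * (1ℚ + a)) (fromℕ-homo-+ 1 (suc k)) ⟩
  (e k - K₁ - (e (suc k) - (1ℚ + K₁))) * (1ℚ + a)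
    ≡⟨ regroup₁ (e k) (e (suc k)) K₁ a ⟩
  (e k + 1ℚ) * (1ℚ + a) - e (suc k) * (1ℚ + a)
    ≡⟨ cong (λ y → (e k + 1ℚ) * (1ℚ + a) - y) (e-rec k) ⟩
  (e k + 1ℚ) * (1ℚ + a) - (1ℚ + 2ℚ * a + (1ℚ - a) * e k)
    ≡⟨ regroup₂ (e k) a ⟩
  a * (2ℚ * e k - 1ℚ)
    ∎
  where
  open ≡-Reasoning
  a  = α k
  K₁ = fromℕ (suc k)
  regroup₁ : ∀ x y m a → (x - m - (y - (1ℚ + m))) * (1ℚ + a) ≡ (x + 1ℚ) * (1ℚ + a) - y * (1ℚ + a)
  regroup₁ = solve-∀ ring
  regroup₂ : ∀ x a → (x + 1ℚ) * (1ℚ + a) - (1ℚ + 2ℚ * a + (1ℚ - a) * x) ≡ a * (2ℚ * x - 1ℚ)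
  regroup₂ = solve-∀ ring

0≤2e-1 : ∀ k → 0ℚ ≤ 2ℚ * e k - 1ℚ
0≤2e-1 k = p≤q⇒0≤q-p (begin
  1ℚ           ≤⟨ 1≤e k ⟩
  e k          ≤⟨ p≤p+q (≤-trans (0≤fromℕ 1) (1≤e k)) ⟩
  e k + e k    ≡⟨ double (e k) ⟩
  2ℚ * e k     ∎)
  where
  open ≤-Reasoning
  double : ∀ x → x + x ≡ 2ℚ * x
  double = solve-∀ ring

0≤Δf : ∀ k → 0ℚ ≤ f k - f (suc k)
0≤Δf k = *-cancelʳ-≤-pos (1ℚ + α k) {{1+α-pos k}} (begin
  0ℚ * (1ℚ + α k)                ≡⟨ *-zeroˡ (1ℚ + α k) ⟩
  0ℚ                             ≤⟨ 0≤* (0≤α k) (0≤2e-1 k) ⟩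
  α k * (2ℚ * e k - 1ℚ)          ≡⟨ Δf-rec k ⟨
  (f k - f (suc k)) * (1ℚ + α k) ∎)
  where open ≤-Reasoning

f≤1 : ∀ k → f k ≤ 1ℚ
f≤1 k = begin
  f k                    ≡⟨ q≡p-[p-q] (f 0) (f k) ⟩
  f 0 - (f 0 - f k)      ≤⟨ p-q≤p (telescope (λ _ → 0ℚ) f 0≤Δf {j = k} ℕ.z≤n) ⟩
  f 0                    ∎
  where
  open ≤-Reasoning
  q≡p-[p-q] : ∀ p q → q ≡ p - (p - q)
  q≡p-[p-q] = solve-∀ ring

Δf*Q≤2e-1 : ∀ k → (f k - f (suc k)) * Q k ≤ 2ℚ * e k - 1ℚ
Δf*Q≤2e-1 k = *-cancelʳ-≤-pos (1ℚ + α k) {{1+α-pos k}} (begin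
  Δf * Q k * (1ℚ + α k)          ≡⟨ regroup Δf (Q k) (1ℚ + α k) ⟩
  Δf * (1ℚ + α k) * Q k          ≡⟨ cong (_* Q k) (Δf-rec k) ⟩
  α k * (2ℚ * e k - 1ℚ) * Q k    ≡⟨ regroup (α k) (2ℚ * e k - 1ℚ) (Q k) ⟩
  α k * Q k * (2ℚ * e k - 1ℚ)    ≤⟨ *-monoʳ-≤-0≤ (0≤2e-1 k) (α*Q≤1+α k) ⟩
  (1ℚ + α k) * (2ℚ * e k - 1ℚ)   ≡⟨ *-comm (1ℚ + α k) (2ℚ * e k - 1ℚ) ⟩
  (2ℚ * e k - 1ℚ) * (1ℚ + α k)   ∎)
  where
  open ≤-Reasoning
  Δf = f k - f (suc k)
  regroup : ∀ x y z → x * y * z ≡ x * z * y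
  regroup = solve-∀ ring

2e-1≤2k+3 : ∀ k → 2ℚ * e k - 1ℚ ≤ 2 * fromℕ k + 3
2e-1≤2k+3 k = begin
  2ℚ * e k - 1ℚ                  ≡⟨ regroup₁ (e k) K₁ ⟩
  2ℚ * (f k + K₁) - 1ℚ           ≤⟨ +-monoˡ-≤ (- 1ℚ) (*-monoˡ-≤-0≤ (0≤fromℕ 2) f+K₁≤1+K₁) ⟩
  2ℚ * (1ℚ + K₁) - 1ℚ            ≡⟨ cong (λ m → 2ℚ * (1ℚ + m) - 1ℚ) (fromℕ-homo-+ 1 k) ⟩
  2ℚ * (1ℚ + (1ℚ + fromℕ k)) - 1ℚ ≡⟨ regroup₂ (fromℕ k) ⟩
  2 * fromℕ k + 3                ∎
  where
  open ≤-Reasoning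
  K₁ = fromℕ (suc k)
  f+K₁≤1+K₁ : f k + K₁ ≤ 1ℚ + K₁
  f+K₁≤1+K₁ = +-monoˡ-≤ K₁ (f≤1 k)
  regroup₁ : ∀ x m → 2ℚ * x - 1ℚ ≡ 2ℚ * (x - m + m) - 1ℚ
  regroup₁ = solve-∀ ring
  regroup₂ : ∀ n → 2ℚ * (1ℚ + (1ℚ + n)) - 1ℚ ≡ 2 * n + 3
  regroup₂ = solve-∀ ring

T : ℕ → ℚ
T m = (4 * fromℕ m + 10) * t m

0≤T : ∀ m → 0ℚ ≤ T m
0≤T m = 0≤* (+-mono-≤ (0≤* (0≤fromℕ 4) (0≤fromℕ m)) (0≤fromℕ 10)) (0≤t m)

ΔT : ∀ k → T k - T (suc k) ≡ (2 * fromℕ k + 3) * t k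
ΔT k = begin
  (4 * K + 10) * t k - (4 * fromℕ (suc k) + 10) * t (suc k)
    ≡⟨ cong₂ (λ s m → (4 * K + 10) * s - (4 * m + 10) * t (suc k)) (sym (2*t-suc≡t k)) (fromℕ-homo-+ 1 k) ⟩
  (4 * K + 10) * (2ℚ * t (suc k)) - (4 * (1ℚ + K) + 10) * t (suc k)
    ≡⟨ regroup K (t (suc k)) ⟩
  (2 * K + 3) * (2ℚ * t (suc k))
    ≡⟨ cong ((2 * K + 3) *_) (2*t-suc≡t k) ⟩
  (2 * K + 3) * t k
    ∎
  where
  open ≡-Reasoning
  K = fromℕ k
  regroup : ∀ n s → (4 * n + 10) * (2ℚ * s) - (4 * (1ℚ + n) + 10) * s ≡ (2 * n + 3) * (2ℚ * s)
  regroup = solve-∀ ring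

Δf≤ΔT : ∀ k → f k - f (suc k) ≤ T k - T (suc k)
Δf≤ΔT k = begin
  f k - f (suc k)                  ≡⟨ p*Q*t≡p k (f k - f (suc k)) ⟨
  (f k - f (suc k)) * Q k * t k    ≤⟨ *-monoʳ-≤-0≤ (0≤t k) (≤-trans (Δf*Q≤2e-1 k) (2e-1≤2k+3 k)) ⟩
  (2 * fromℕ k + 3) * t k          ≡⟨ ΔT k ⟨
  T k - T (suc k)                  ∎
  where open ≤-Reasoning

-- The modulus of convergence

n<2^n : ∀ n → n ℕ.< 2 ^ n
n<2^n zero    = ℕ.s≤s ℕ.z≤n
n<2^n (suc n) = ℕₚ.+-mono-≤ (ℕₚ.m^n>0 2 n) (ℕₚ.≤-trans (n<2^n n) (ℕₚ.m≤m+n (2 ^ n) 0))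

2^n*2^n≡4^n : ∀ n → 2 ^ n ℕ.* 2 ^ n ≡ 4 ^ n
2^n*2^n≡4^n n = begin
  2 ^ n ℕ.* 2 ^ n  ≡⟨ ℕₚ.^-distribˡ-+-* 2 n n ⟨
  2 ^ (n ℕ.+ n)    ≡⟨ cong (λ m → 2 ^ (n ℕ.+ m)) (ℕₚ.+-identityʳ n) ⟨
  2 ^ (2 ℕ.* n)    ≡⟨ ℕₚ.^-*-assoc 2 2 n ⟨
  4 ^ n            ∎
  where open ≡-Reasoning

modulus : ℕ → ℕ
modulus n = 2 ℕ.* n ℕ.+ 8

modulus-bound : ∀ n → (4 ℕ.* modulus n ℕ.+ 10) ℕ.* suc n ℕ.≤ 2 ^ suc (modulus n)
modulus-bound n = begin
  (4 ℕ.* (2 ℕ.* n ℕ.+ 8) ℕ.+ 10) ℕ.* suc n  ≤⟨ ℕₚ.*-monoˡ-≤ (suc n) linear ⟩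
  2 ^ 9 ℕ.* suc n ℕ.* suc n                ≡⟨ ℕₚ.*-assoc (2 ^ 9) (suc n) (suc n) ⟩
  2 ^ 9 ℕ.* (suc n ℕ.* suc n)              ≤⟨ ℕₚ.*-monoʳ-≤ (2 ^ 9) (ℕₚ.*-mono-≤ (n<2^n n) (n<2^n n)) ⟩
  2 ^ 9 ℕ.* (2 ^ n ℕ.* 2 ^ n)              ≡⟨ cong (2 ^ 9 ℕ.*_) (ℕₚ.^-distribˡ-+-* 2 n n) ⟨
  2 ^ 9 ℕ.* 2 ^ (n ℕ.+ n)                  ≡⟨ ℕₚ.^-distribˡ-+-* 2 9 (n ℕ.+ n) ⟨
  2 ^ (9 ℕ.+ (n ℕ.+ n))                    ≡⟨ cong (2 ^_) (exponent n) ⟩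
  2 ^ suc (2 ℕ.* n ℕ.+ 8)                  ∎
  where
  open ℕₚ.≤-Reasoning
  slack : ∀ n → 4 ℕ.* (2 ℕ.* n ℕ.+ 8) ℕ.+ 10 ℕ.+ (504 ℕ.* n ℕ.+ 470) ≡ 2 ^ 9 ℕ.* suc n
  slack = ℕ.solve-∀
  linear : 4 ℕ.* (2 ℕ.* n ℕ.+ 8) ℕ.+ 10 ℕ.≤ 2 ^ 9 ℕ.* suc n
  linear = ℕₚ.≤-trans (ℕₚ.m≤m+n _ (504 ℕ.* n ℕ.+ 470)) (ℕₚ.≤-reflexive (slack n))
  exponent : ∀ n → 9 ℕ.+ (n ℕ.+ n) ≡ suc (2 ℕ.* n ℕ.+ 8)
  exponent = ℕ.solve-∀

T∘modulus≤1/suc : ∀ n → T (modulus n) ≤ + 1 / suc n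
T∘modulus≤1/suc n = begin
  T M                                               ≡⟨ *-identityʳ (T M) ⟨
  T M * 1ℚ                                          ≡⟨ cong (T M *_) (m/n*n≡m 1 (suc n)) ⟨
  T M * (r * fromℕ (suc n))                         ≡⟨ regroup (fromℕ M) (t M) r (fromℕ (suc n)) ⟩
  r * (t M * ((4 * fromℕ M + 10) * fromℕ (suc n)))  ≡⟨ cong (λ q → r * (t M * q)) cast ⟨
  r * (t M * fromℕ ((4 ℕ.* M ℕ.+ 10) ℕ.* suc n))    ≤⟨ *-monoˡ-≤-0≤ (0≤m/n 1 (suc n)) t*[4M+10][n+1]≤1 ⟩
  r * 1ℚ                                            ≡⟨ *-identityʳ r ⟩
  r                                                 ∎
  where
  open ≤-Reasoning
  M = modulus n
  r = + 1 / suc n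
  t*[4M+10][n+1]≤1 : t M * fromℕ ((4 ℕ.* M ℕ.+ 10) ℕ.* suc n) ≤ 1ℚ
  t*[4M+10][n+1]≤1 = 1/n*m≤1 {{ℕₚ.m^n≢0 2 (suc M)}} (modulus-bound n)
  regroup : ∀ m s r n → (4 * m + 10) * s * (r * n) ≡ r * (s * ((4 * m + 10) * n))
  regroup = solve-∀ ring
  cast : fromℕ ((4 ℕ.* M ℕ.+ 10) ℕ.* suc n) ≡ (4 * fromℕ M + 10) * fromℕ (suc n)
  cast = trans (fromℕ-homo-* (4 ℕ.* M ℕ.+ 10) (suc n))
           (cong (_* fromℕ (suc n)) (trans (fromℕ-homo-+ (4 ℕ.* M) 10) (cong (_+ 10) (fromℕ-homo-* 4 M))))

-- The estimate

bound≡4*[k+7]*t*t : ∀ k → bound k ≡ 4 * (fromℕ k + 7) * (t k * t k)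
bound≡4*[k+7]*t*t k = begin
  bound k                                     ≡⟨ trans (p*Q*t≡p k _) (p*Q*t≡p k (bound k)) ⟨
  bound k * Q k * t k * Q k * t k             ≡⟨ regroup₁ (bound k) (Q k) (t k) ⟩
  bound k * (Q k * Q k) * (t k * t k)         ≡⟨ cong (λ q → bound k * q * (t k * t k)) Q*Q≡4*4^k ⟩
  bound k * (4 * fromℕ (4 ^ k)) * (t k * t k) ≡⟨ regroup₂ (bound k) (fromℕ (4 ^ k)) (t k * t k) ⟩
  4 * (bound k * fromℕ (4 ^ k)) * (t k * t k) ≡⟨ cong (λ q → 4 * q * (t k * t k)) bound*4^k ⟩
  4 * fromℕ (k ℕ.+ 7) * (t k * t k)           ≡⟨ cong (λ q → 4 * q * (t k * t k)) (fromℕ-homo-+ k 7) ⟩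
  4 * (fromℕ k + 7) * (t k * t k)             ∎
  where
  open ≡-Reasoning
  bound*4^k : bound k * fromℕ (4 ^ k) ≡ fromℕ (k ℕ.+ 7)
  bound*4^k = m/n*n≡m (k ℕ.+ 7) (4 ^ k) {{ℕₚ.m^n≢0 4 k}}
  Q*Q≡4*4^k : Q k * Q k ≡ 4 * fromℕ (4 ^ k)
  Q*Q≡4*4^k = trans (sym (fromℕ-homo-* (2 ^ suc k) (2 ^ suc k)))
                (trans (cong fromℕ (2^n*2^n≡4^n (suc k))) (fromℕ-homo-* 4 (4 ^ k)))
  regroup₁ : ∀ b q s → b * q * s * q * s ≡ b * (q * q) * (s * s)
  regroup₁ = solve-∀ ring
  regroup₂ : ∀ b m s → b * (4 * m) * s ≡ 4 * (b * m) * s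
  regroup₂ = solve-∀ ring

T*t≤bound : ∀ k → T k * t k ≤ bound k
T*t≤bound k = begin
  (4 * K + 10) * t k * t k        ≡⟨ *-assoc (4 * K + 10) (t k) (t k) ⟩
  (4 * K + 10) * (t k * t k)      ≤⟨ *-monoʳ-≤-0≤ (0≤* (0≤t k) (0≤t k)) (p≤p+q {4 * K + 10} (0≤fromℕ 18)) ⟩
  (4 * K + 10 + 18) * (t k * t k) ≡⟨ cong (_* (t k * t k)) (regroup K) ⟩
  4 * (K + 7) * (t k * t k)       ≡⟨ bound≡4*[k+7]*t*t k ⟨
  bound k                         ∎
  where
  open ≤-Reasoning
  K = fromℕ k
  regroup : ∀ n → 4 * n + 10 + 18 ≡ 4 * (n + 7)
  regroup = solve-∀ ring

δ-approx : ∀ k c → δ k - (+ suc k / 1 + c) * t k ≡ (f k - c) * t k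
δ-approx k c = begin
  δ k - (+ suc k / 1 + c) * t k
    ≡⟨ cong₂ (λ x m → x - (m + c) * t k) (sym (p*Q*t≡p k (δ k))) (n/1≡fromℕ (suc k)) ⟩
  e k * t k - (fromℕ (suc k) + c) * t k
    ≡⟨ regroup (e k) (fromℕ (suc k)) c (t k) ⟩
  (f k - c) * t k
    ∎
  where
  open ≡-Reasoning
  regroup : ∀ x m c s → x * s - (m + c) * s ≡ (x - m - c) * s
  regroup = solve-∀ ring

lemma5p2 : ∃ λ (c : ℝ) → ∀ (k : ℕ) → DistLe (ν k - γ k) (approx k c) (bound k)
lemma5p2 = limit , approximation
  where
  open Limit f T modulus 0≤Δf Δf≤ΔT 0≤T T∘modulus≤1/suc
  approximation : ∀ k → DistLe (ν k - γ k) (approx k limit) (bound k)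
  approximation k n = begin
    ∣ δ k - approx k limit n ∣       ≡⟨ cong ∣_∣ (δ-approx k (seq limit n)) ⟩
    ∣ (f k - seq limit n) * t k ∣    ≡⟨ ∣p*q∣≡∣p∣*∣q∣ (f k - seq limit n) (t k) ⟩
    ∣ f k - seq limit n ∣ * ∣ t k ∣  ≡⟨ cong (∣ f k - seq limit n ∣ *_) (0≤p⇒∣p∣≡p (0≤t k)) ⟩
    ∣ f k - seq limit n ∣ * t k      ≤⟨ *-monoʳ-≤-0≤ (0≤t k) (∣f-limit∣≤T+1/suc k n) ⟩
    (T k + + 1 / suc n) * t k        ≡⟨ *-distribʳ-+ (t k) (T k) (+ 1 / suc n) ⟩
    T k * t k + + 1 / suc n * t k    ≤⟨ +-mono-≤ (T*t≤bound k) (p*t≤p k (0≤m/n 1 (suc n))) ⟩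
    bound k + + 1 / suc n            ∎
    where open ≤-Reasoning
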